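{- Let $\mathrm{M}$ be a matroid of rank $r$, let $G$ be a proper flat, and let $y \in A^{r-1}(\mathrm{M})$. Then $\deg(\varphi_G(y)) = \deg(x_G \cdot y)$.
   Context: A matroid $\mathrm{M}$ is a finite nonempty atomic ranked lattice $\mathcal{L}_{\mathrm{M}}$ (every element is the join of the atoms below it; every maximal chain in $[\emptyset, F]$ has length $\operatorname{rk}(F)$) whose rank function $\operatorname{rk}$ is submodular; $r = \operatorname{rk}(E)$ where $\emptyset$, $E$ are the minimal and maximal flats. A flat is proper if it is not $E$. Let $\overline{\mathcal{L}}_{\mathrm{M}} = \mathcal{L}_{\mathrm{M}} \setminus \{\emptyset\}$. The augmented Chow ring $A^{\bullet}(\mathrm{M})$ is the quotient of $\mathbb{Z}[h_F]_{F \in \overline{\mathcal{L}}_{\mathrm{M}}}$ by $((h_{F} - h_{G \vee F})(h_G - h_{G \vee F}) : F, G) + (h_a^2,\ h_ah_F - h_ah_{F \vee a} : F \in \overline{\mathcal{L}}_{\mathrm{M}},\ a \text{ atom})$; the Chow ring $\underline{A}^{\bullet}(\mathrm{M})$ is the quotient of $\mathbb{Z}[h_F]_{F \in \overline{\mathcal{L}}_{\mathrm{M}}}$ by $((h_{F} - h_{G \vee F})(h_G - h_{G \vee F}) : F, G) + (h_a : a \text{ atom})$; both graded with $h_F$ in degree $1$. For a matroid of rank $r$, $\deg \colon A^r(\mathrm{M}) \to \mathbb{Z}$ is the isomorphism with $\deg(h_{F_1}\dotsb h_{F_r}) = 1$ if $\operatorname{rk}(\bigvee_{i\in T}F_i)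 \ge |T|$ for all $T \subseteq [r]$ and $0$ otherwise, and $\deg \colon \underline{A}^{r-1}(\mathrm{M}) \to \mathbb{Z}$ is the isomorphism with $\deg(h_{F_1}\dotsb h_{F_{r-1}}) = 1$ if $\operatorname{rk}(\bigvee_{i\in T}F_i) \ge |T|+1$ for all nonempty $T \subseteq [r-1]$ and $0$ otherwise; degree maps are extended by zero to all other graded pieces. For a flat $G$, $\mathrm{M}^G$ has lattice of flats $[\emptyset, G]$ and $\mathrm{M}_G$ has lattice of flats $[G, E]$ (minimal element $G$); $A^{\bullet}(\mathrm{M}^\emptyset) := \mathbb{Z}$ (with degree map the identity in degree $0$). The degree map on $A^{\bullet}(\mathrm{M}^G) \otimes \underline{A}^{\bullet}(\mathrm{M}_G)$ is the tensor product of the degree maps, an isomorphism $A^{\operatorname{rk}(G)}(\mathrm{M}^G) \otimes \underline{A}^{r-1-\operatorname{rk}(G)}(\mathrm{M}_G) \to \mathbb{Z}$, extended by zero. $\varphi_G \colon A^{\bullet}(\mathrm{M}) \to A^{\bullet}(\mathrm{M}^G) \otimes \underline{A}^{\bullet}(\mathrm{M}_G)$ is the ring homomorphism with $\varphi_G(h_F) = h_F \otimes 1$ if $F \le G$ and $\varphi_G(h_F) = 1 \otimes h_{F \vee G}$ otherwise. With $\mathcal{A}$ the set of atoms not contained in $G$ and $h_\emptyset = 0$, $x_G = -\sum_{S \subseteq \mathcal{A}} (-1)^{|S|} h_{G \vee \bigvee_{a \in S} a} \in A^{1}(\mathrm{M})$. -}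

module Defs where

open import Data.Nat as ℕ using (ℕ; zero; suc; _∸_)
open import Data.Nat.Properties as ℕP using ()
open import Data.Integer as ℤ using (ℤ; +_; -_)
open import Data.Fin using (Fin)
open import Data.Fin.Properties as FinP using (all?)
open import Data.List using (List; []; _∷_; length; foldr; filter; map; allFin)
open import Data.Product using (_×_; _,_; proj₁; proj₂)
open import Data.Sum using (_⊎_)
open import Data.List.Relation.Unary.All using (All)
open import Data.Bool using (Bool; true; false; if_then_else_; _∧_)
open import Relation.Nullary using (¬_; Dec; yes; no; does)
open import Relation.Nullary.Decidable using (_×-dec_; _⊎-dec_; _→-dec_; ¬?)
open import Relation.Binary using (Decidable)
open import Relation.Binary.PropositionalEquality using (_≡_; _≢_)

module _ {A : Set} (_≤_ : A → A → Set) where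
  Lt : A → A → Set
  Lt a b = (a ≤ b) × (a ≢ b)

  Covers : A → A → Set
  Covers a b = Lt a b × (∀ c → a ≤ c → c ≤ b → (c ≡ a) ⊎ (c ≡ b))

  -- SatChain a cs b : a = c₀ ⋖ c₁ ⋖ ... ⋖ cₖ = b with cs = c₁ … cₖ,
  -- i.e. a maximal chain of the interval [a, b]; its length is length cs.
  data SatChain : A → List A → A → Set where
    done : ∀ {a} → SatChain a [] a
    step : ∀ {a b c cs} → Covers a b → SatChain b cs c → SatChain a (b ∷ cs) c

-- Matroids as finite atomic ranked lattices with submodular rank.
-- Flats are Fin n.

record Matroid : Set₁ where
  field
    n     : ℕ
    _≤_   : Fin n → Fin n → Set
    _≤?_  : Decidable _≤_
    ≤-refl    : ∀ x → x ≤ x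
    ≤-trans   : ∀ {x y z} → x ≤ y → y ≤ z → x ≤ z
    ≤-antisym : ∀ {x y} → x ≤ y → y ≤ x → x ≡ y
    _∨_   : Fin n → Fin n → Fin n
    ∨-ubˡ : ∀ x y → x ≤ (x ∨ y)
    ∨-ubʳ : ∀ x y → y ≤ (x ∨ y)
    ∨-lub : ∀ {x y z} → x ≤ z → y ≤ z → (x ∨ y) ≤ z
    _∧ₗ_  : Fin n → Fin n → Fin n
    ∧-lbˡ : ∀ x y → (x ∧ₗ y) ≤ x
    ∧-lbʳ : ∀ x y → (x ∧ₗ y) ≤ y
    ∧-glb : ∀ {x y z} → z ≤ x → z ≤ y → z ≤ (x ∧ₗ y)
    ⊥ₗ    : Fin n
    ⊤ₗ    : Fin n
    ⊥-min : ∀ x → ⊥ₗ ≤ x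
    ⊤-max : ∀ x → x ≤ ⊤ₗ
    rk    : Fin n → ℕ
    -- atomic: every flat is the join (least upper bound) of the atoms below it
    atomic : ∀ F H → (∀ a → Covers _≤_ ⊥ₗ a → a ≤ F → a ≤ H) → F ≤ H
    ranked : ∀ F cs → SatChain _≤_ ⊥ₗ cs F → length cs ≡ rk F
    submodular : ∀ F G → rk (F ∨ G) ℕ.+ rk (F ∧ₗ G) ℕ.≤ rk F ℕ.+ rk G

  Flat : Set
  Flat = Fin n

  r : ℕ
  r = rk ⊤ₗ

  Atom : Flat → Set
  Atom a = Covers _≤_ ⊥ₗ a

  atom? : ∀ a → Dec (Atom a)
  atom? a = ((⊥ₗ ≤? a) ×-dec ¬? (⊥ₗ FinP.≟ a))
            ×-dec all? (λ c → (⊥ₗ ≤? c) →-dec ((c ≤? a) →-dec ((c FinP.≟ ⊥ₗ) ⊎-dec (c FinP.≟ a))))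

  atoms : List Flat
  atoms = filter atom? (allFin n)

  joinFrom : Flat → List Flat → Flat
  joinFrom b = foldr _∨_ b

-- Sub-lists by position (all subsets T of the index set of a list)

sublists : {A : Set} → List A → List (List A)
sublists []       = [] ∷ []
sublists (x ∷ xs) = let s = sublists xs in s Data.List.++ map (x ∷_) s

allB : {A : Set} → (A → Bool) → List A → Bool
allB p = foldr (λ x b → p x ∧ b) true

sumℤ : List ℤ → ℤ
sumℤ = foldr ℤ._+_ (+ 0)

-- Degree maps on monomials (a monomial h_{F₁}⋯h_{Fₖ} is the list F₁ … Fₖ)

module Degrees (M : Matroid) where
  open Matroid M

  -- Augmented Chow ring of a matroid whose flats are an interval [bot, ·] with
  -- rank function ρ and total rank R:
  --   deg = 1 iff k = R and ρ(⋁_T F_i) ≥ |T| for all T ⊆ [k]; else 0.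
  degAug : (ρ : Flat → ℕ) (R : ℕ) (bot : Flat) → List Flat → ℤ
  degAug ρ R bot fs =
    if does (length fs ℕ.≟ R)
       ∧ allB (λ T → does (length T ℕ.≤? ρ (joinFrom bot T))) (sublists fs)
    then + 1 else + 0

  nonempty : List Flat → Bool
  nonempty []      = false
  nonempty (_ ∷ _) = true

  -- Chow ring: deg = 1 iff k = R - 1 and ρ(⋁_T F_i) ≥ |T|+1 for all nonempty T.
  degChow : (ρ : Flat → ℕ) (R : ℕ) (bot : Flat) → List Flat → ℤ
  degChow ρ R bot fs =
    if does (length fs ℕ.≟ R ∸ 1)
       ∧ allB (λ T → if nonempty T then does (suc (length T) ℕ.≤? ρ (joinFrom bot T)) else true)
              (sublists fs)
    then + 1 else + 0

  degM : List Flat → ℤ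
  degM = degAug rk r ⊥ₗ

  -- deg on A•(M^G) : lattice [∅, G], rank rk, total rank rk G
  degUpper : Flat → List Flat → ℤ
  degUpper G = degAug rk (rk G) ⊥ₗ

  -- deg on the Chow ring of M_G : lattice [G, E], rank rk(-) - rk G,
  -- total rank r - rk G, minimal flat G
  degLower : Flat → List Flat → ℤ
  degLower G = degChow (λ F → rk F ∸ rk G) (r ∸ rk G) G

  -- deg(φ_G(h_{F₁}⋯h_{Fₖ})) : φ_G sends the monomial to
  -- (∏_{F_i ≤ G} h_{F_i}) ⊗ (∏_{F_i ≰ G} h_{F_i ∨ G}); degree is the tensor product.
  degφMono : Flat → List Flat → ℤ
  degφMono G fs =
    degUpper G (filter (λ F → F ≤? G) fs)
    ℤ.* degLower G (map (λ F → F ∨ G) (filter (λ F → ¬? (F ≤? G)) fs))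

  atomsOff : Flat → List Flat
  atomsOff G = filter (λ a → ¬? (a ≤? G)) atoms

  sign : ℕ → ℤ
  sign zero    = + 1
  sign (suc k) = - sign k

  -- deg(h_H · m) with the convention h_∅ = 0
  degWith : Flat → List Flat → ℤ
  degWith H fs = if does (H FinP.≟ ⊥ₗ) then + 0 else degM (H ∷ fs)

  -- deg(x_G · m), x_G = - Σ_{S ⊆ atomsOff G} (-1)^{|S|} h_{G ∨ ⋁S}
  degxMono : Flat → List Flat → ℤ
  degxMono G fs =
    sumℤ (map (λ S → - (sign (length S) ℤ.* degWith (joinFrom G S) fs))
              (sublists (atomsOff G)))

-- A polynomial in the h_F: a formal ℤ-linear combination of monomials.
Poly : Matroid → Set
Poly M = List (ℤ × List (Matroid.Flat M))

HomogDeg : (M : Matroid) → ℕ → Poly M → Set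
HomogDeg M d = All (λ t → (length (proj₂ t) ≡ d) × All (λ F → F ≢ Matroid.⊥ₗ M) (proj₂ t))

degφ : (M : Matroid) → Matroid.Flat M → Poly M → ℤ
degφ M G y = sumℤ (map (λ t → proj₁ t ℤ.* Degrees.degφMono M G (proj₂ t)) y)

degx : (M : Matroid) → Matroid.Flat M → Poly M → ℤ
degx M G y = sumℤ (map (λ t → proj₁ t ℤ.* Degrees.degxMono M G (proj₂ t)) y)

-- On a monomial h = h_{F₁} ⋯ h_{F_{r-1}} both sides are 0 or 1. Call a flat K deficient
-- for the F_i if rk(K ∨ ⋁_{i∈T} F_i) ≤ |T| for some T; then h_K · h satisfies the Hall–Rado
-- condition exactly when h does and K is not deficient. When h satisfies Hall–Rado,
-- submodularity (applied to the union and the intersection of two witnesses) makes the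
-- deficient flats a down-set closed under joins, so the inclusion–exclusion defining x_G
-- collapses: deg(x_G · h) = 1 exactly when G is the largest deficient flat. On the other
-- side, deg φ_G(h) = 1 says that the F_i below G number rk G and satisfy Hall–Rado in M^G,
-- while the others satisfy the Chow-ring condition in M_G; submodularity against G and
-- atomicity show that this is the same condition.

module Submission where

open import Defs
open import Relation.Binary.PropositionalEquality
  using (_≡_; _≢_; refl; sym; trans; cong; cong₂; subst; isEquivalence; module ≡-Reasoning)
open import Data.Nat using (_∸_)

open import Data.Bool using (Bool; true; false; not; _∧_; if_then_else_)
open import Data.Empty using (⊥-elim)
import Data.Fin.Properties as Fin
open import Data.Fin.Induction using (po-wellFounded; po-noetherian)
open import Data.Integer as ℤ using (ℤ; +_; -_)
import Data.Integer.Properties as ℤP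
open import Algebra.Properties.CommutativeSemigroup ℤP.+-commutativeSemigroup using (interchange)
open import Data.Integer.Tactic.RingSolver using (solve-∀)
open import Data.List using (List; []; _∷_; _++_; length; map; filter; allFin)
open import Data.List.Properties using (map-∘; map-cong; length-map; length-++; filter-all)
open import Data.List.Membership.Propositional using (_∈_; find; lose)
open import Data.List.Membership.Propositional.Properties
  using (∈-++⁺ˡ; ∈-++⁺ʳ; ∈-++⁻; ∈-map⁺; ∈-map⁻; ∈-filter⁺; ∈-filter⁻; ∈-allFin)
open import Data.List.Relation.Binary.Sublist.Propositional
  using (_⊆_; []; _∷_; _∷ʳ_; ⊆-trans; lookup; minimum)
open import Data.List.Relation.Binary.Sublist.Propositional.Properties
  using (filter-⊆; filter⁺; map⁺; All-resp-⊆; length-mono-≤)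
open import Data.List.Relation.Unary.All as All using (All; []; _∷_)
open import Data.List.Relation.Unary.All.Properties using (all-filter)
open import Data.List.Relation.Unary.Any using (here; there; any?)
open import Data.Nat as ℕ using (suc)
import Data.Nat.Properties as ℕ
open import Data.Product using (∃; _×_; _,_; proj₁; proj₂; map₂)
open import Data.Sum as Sum using (_⊎_; inj₁; inj₂; [_,_])
open import Data.Unit using (⊤)
open import Function using (_∘_; id; flip; _⇔_; mk⇔; Equivalence)
open import Induction.WellFounded using (Acc; acc)
open import Relation.Binary using (IsPartialOrder)
open import Relation.Nullary using (¬_; Dec; yes; no; does; proof; _because_)
open import Relation.Nullary.Decidable using (_×-dec_; ¬?; map′; decidable-stable)
open import Relation.Nullary.Reflects using (Reflects; ofʸ; ofⁿ; det; _×-reflects_; ¬-reflects)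
import Relation.Unary as U

open Equivalence using (to; from)

private
  variable
    A B : Set

reflects-map : ∀ {b} → (A → B) → (B → A) → Reflects A b → Reflects B b
reflects-map f g (ofʸ a)  = ofʸ (f a)
reflects-map f g (ofⁿ ¬a) = ofⁿ (¬a ∘ g)

ind : Bool → ℤ
ind b = if b then + 1 else + 0

IsIndicator : Set → ℤ → Set
IsIndicator A n = ∃ λ b → Reflects A b × n ≡ ind b

ind-∧ : ∀ a b → ind (a ∧ b) ≡ ind a ℤ.* ind b
ind-∧ false b = refl
ind-∧ true  b = sym (ℤP.*-identityˡ (ind b))

ind-not-∧ : ∀ a b → ind b ℤ.+ - ind a ℤ.* ind b ≡ ind (not a ∧ b)
ind-not-∧ false false = refl
ind-not-∧ false true  = refl
ind-not-∧ true  false = refl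
ind-not-∧ true  true  = refl

ind-not : ∀ b → ind (not b) ≡ + 1 ℤ.- ind b
ind-not false = refl
ind-not true  = refl

ind-*-cong : ∀ {b x y} → Reflects A b → (A → x ≡ y) → ind b ℤ.* x ≡ ind b ℤ.* y
ind-*-cong (ofʸ a) eq = cong (+ 1 ℤ.*_) (eq a)
ind-*-cong (ofⁿ _) _  = refl

ind-nand : ∀ s a b → - (s ℤ.* ind (not (a ∧ b))) ≡ ind a ℤ.* (s ℤ.* ind b) ℤ.+ - s
ind-nand s a b =
  trans (cong (λ v → - (s ℤ.* v)) (trans (ind-not (a ∧ b)) (cong (ℤ._-_ (+ 1)) (ind-∧ a b))))
        (expand s (ind a) (ind b))
  where
  expand : ∀ s x y → - (s ℤ.* (+ 1 ℤ.- x ℤ.* y)) ≡ x ℤ.* (s ℤ.* y) ℤ.+ - s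
  expand = solve-∀

dec-indicator : (d : Dec A) → IsIndicator A (ind (does d))
dec-indicator d = does d , proof d , refl

indicator-map : ∀ {n} → (A → B) → (B → A) → IsIndicator A n → IsIndicator B n
indicator-map f g (b , r , eq) = b , reflects-map f g r , eq

indicator-unique : ∀ {m n} → (A → B) → (B → A) → IsIndicator A m → IsIndicator B n → m ≡ n
indicator-unique f g (a , ra , refl) (b , rb , refl) = cong ind (det (reflects-map f g ra) rb)

indicator-* : ∀ {m n} → IsIndicator A m → IsIndicator B n → IsIndicator (A × B) (m ℤ.* n)
indicator-* (a , ra , refl) (b , rb , refl) = a ∧ b , (ra ×-reflects rb) , sym (ind-∧ a b)

indicator-absurd : ∀ {n} → ¬ A → IsIndicator A n → n ≡ + 0
indicator-absurd ¬a (b , r , refl) = cong ind (det r (ofⁿ ¬a))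

allB-reflects : ∀ {P : A → Set} {p : A → Bool} → (∀ x → Reflects (P x) (p x)) →
                ∀ xs → Reflects (All P xs) (allB p xs)
allB-reflects r []       = ofʸ []
allB-reflects r (x ∷ xs) =
  reflects-map (λ (px , pxs) → px ∷ pxs) (λ all → All.head all , All.tail all)
               (r x ×-reflects allB-reflects r xs)

∈-sublists⁺ : ∀ {xs ys : List A} → ys ⊆ xs → ys ∈ sublists xs
∈-sublists⁺ []         = here refl
∈-sublists⁺ (x ∷ʳ τ)   = ∈-++⁺ˡ (∈-sublists⁺ τ)
∈-sublists⁺ {xs = x ∷ xs} (refl ∷ τ) = ∈-++⁺ʳ (sublists xs) (∈-map⁺ (x ∷_) (∈-sublists⁺ τ))

∈-sublists⁻ : ∀ (xs : List A) {ys} → ys ∈ sublists xs → ys ⊆ xs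
∈-sublists⁻ [] (here refl) = []
∈-sublists⁻ (x ∷ xs) m with ∈-++⁻ (sublists xs) m
... | inj₁ m′ = x ∷ʳ ∈-sublists⁻ xs m′
... | inj₂ m′ with ∈-map⁻ (x ∷_) m′
...   | _ , m″ , refl = refl ∷ ∈-sublists⁻ xs m″

allB-sublists-reflects : ∀ {P : List A → Set} {p : List A → Bool} →
                         (∀ ys → Reflects (P ys) (p ys)) →
                         ∀ xs → Reflects (∀ {ys} → ys ⊆ xs → P ys) (allB p (sublists xs))
allB-sublists-reflects r xs =
  reflects-map (λ all τ → All.lookup all (∈-sublists⁺ τ))
               (λ h → All.tabulate (h ∘ ∈-sublists⁻ xs))
               (allB-reflects r (sublists xs))

⊆-map⁻ : ∀ (f : A → B) xs {ys} → ys ⊆ map f xs → ∃ λ zs → zs ⊆ xs × ys ≡ map f zs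
⊆-map⁻ f []       []         = [] , [] , refl
⊆-map⁻ f (x ∷ xs) (_ ∷ʳ τ)   = let zs , σ , eq = ⊆-map⁻ f xs τ in
                               zs , x ∷ʳ σ , eq
⊆-map⁻ f (x ∷ xs) (refl ∷ τ) = let zs , σ , eq = ⊆-map⁻ f xs τ in
                               x ∷ zs , refl ∷ σ , cong (f x ∷_) eq

length-filter-¬ : ∀ {P : A → Set} (P? : U.Decidable P) xs →
                  length (filter P? xs) ℕ.+ length (filter (¬? ∘ P?) xs) ≡ length xs
length-filter-¬ P? []       = refl
length-filter-¬ P? (x ∷ xs) with P? x
... | yes _ = cong suc (length-filter-¬ P? xs)
... | no  _ = trans (ℕ.+-suc _ _) (cong suc (length-filter-¬ P? xs))

suc-≤-∸⇔ : ∀ {m n o} → n ℕ.≤ o → (suc m ℕ.≤ o ∸ n) ⇔ (n ℕ.+ m ℕ.< o)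
suc-≤-∸⇔ {m} {n} {o} n≤o = mk⇔
  (λ h → subst (ℕ._≤ o) (cong suc (ℕ.+-comm m n)) (ℕ.m≤o∸n⇒m+n≤o (suc m) n≤o h))
  (λ h → ℕ.m+n≤o⇒m≤o∸n (suc m) (subst (ℕ._≤ o) (cong suc (ℕ.+-comm n m)) h))

All∧All¬⇒[] : ∀ {P : A → Set} {xs} → All P xs → All (¬_ ∘ P) xs → xs ≡ []
All∧All¬⇒[] []       []         = refl
All∧All¬⇒[] (p ∷ _) (¬p ∷ _) = ⊥-elim (¬p p)

-- Union and intersection of two sublists of zs, taken as sets of positions in zs.
record UnionInter (xs ys zs : List A) : Set where
  field
    union inter        : List A
    union-⊆            : union ⊆ zs
    inter-⊆ˡ           : inter ⊆ xs
    inter-⊆ʳ           : inter ⊆ ys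
    union-∈            : ∀ {u} → u ∈ union → u ∈ xs ⊎ u ∈ ys
    length-union-inter : length union ℕ.+ length inter ≡ length xs ℕ.+ length ys

⊆-union-inter : ∀ {xs ys zs : List A} → xs ⊆ zs → ys ⊆ zs → UnionInter xs ys zs
⊆-union-inter [] [] = record
  { union = [] ; inter = [] ; union-⊆ = [] ; inter-⊆ˡ = [] ; inter-⊆ʳ = []
  ; union-∈ = λ () ; length-union-inter = refl }
⊆-union-inter (z ∷ʳ τ) (.z ∷ʳ σ) = let open UnionInter (⊆-union-inter τ σ) in record
  { union = union ; inter = inter ; union-⊆ = z ∷ʳ union-⊆ ; inter-⊆ˡ = inter-⊆ˡ
  ; inter-⊆ʳ = inter-⊆ʳ ; union-∈ = union-∈ ; length-union-inter = length-union-inter }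
⊆-union-inter {xs = xs} (z ∷ʳ τ) (refl ∷ σ) = let open UnionInter (⊆-union-inter τ σ) in record
  { union = z ∷ union ; inter = inter ; union-⊆ = refl ∷ union-⊆ ; inter-⊆ˡ = inter-⊆ˡ
  ; inter-⊆ʳ = z ∷ʳ inter-⊆ʳ
  ; union-∈ = λ { (here refl) → inj₂ (here refl) ; (there m) → Sum.map id there (union-∈ m) }
  ; length-union-inter = trans (cong suc length-union-inter) (sym (ℕ.+-suc (length xs) _)) }
⊆-union-inter (refl ∷ τ) (z ∷ʳ σ) = let open UnionInter (⊆-union-inter τ σ) in record
  { union = z ∷ union ; inter = inter ; union-⊆ = refl ∷ union-⊆ ; inter-⊆ˡ = z ∷ʳ inter-⊆ˡ
  ; inter-⊆ʳ = inter-⊆ʳ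
  ; union-∈ = λ { (here refl) → inj₁ (here refl) ; (there m) → Sum.map there id (union-∈ m) }
  ; length-union-inter = cong suc length-union-inter }
⊆-union-inter {xs = _ ∷ xs} (refl ∷ τ) (refl ∷ σ) =
  let open UnionInter (⊆-union-inter τ σ) in record
  { union = _ ∷ union ; inter = _ ∷ inter ; union-⊆ = refl ∷ union-⊆
  ; inter-⊆ˡ = refl ∷ inter-⊆ˡ ; inter-⊆ʳ = refl ∷ inter-⊆ʳ
  ; union-∈ = λ { (here refl) → inj₁ (here refl) ; (there m) → Sum.map there there (union-∈ m) }
  ; length-union-inter = cong suc (trans (ℕ.+-suc _ _)
                           (trans (cong suc length-union-inter) (sym (ℕ.+-suc (length xs) _)))) }

sumℤ-++ : ∀ (f : A → ℤ) xs ys → sumℤ (map f (xs ++ ys)) ≡ sumℤ (map f xs) ℤ.+ sumℤ (map f ys)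
sumℤ-++ f []       ys = sym (ℤP.+-identityˡ _)
sumℤ-++ f (x ∷ xs) ys = trans (cong (ℤ._+_ (f x)) (sumℤ-++ f xs ys)) (sym (ℤP.+-assoc (f x) _ _))

sumℤ-+ : ∀ (f g : A → ℤ) xs →
         sumℤ (map (λ x → f x ℤ.+ g x) xs) ≡ sumℤ (map f xs) ℤ.+ sumℤ (map g xs)
sumℤ-+ f g []       = refl
sumℤ-+ f g (x ∷ xs) =
  trans (cong (ℤ._+_ (f x ℤ.+ g x)) (sumℤ-+ f g xs)) (interchange (f x) (g x) _ _)

sumℤ-scale : ∀ c (f : A → ℤ) xs → sumℤ (map (λ x → c ℤ.* f x) xs) ≡ c ℤ.* sumℤ (map f xs)
sumℤ-scale c f []       = sym (ℤP.*-zeroʳ c)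
sumℤ-scale c f (x ∷ xs) =
  trans (cong (ℤ._+_ (c ℤ.* f x)) (sumℤ-scale c f xs)) (sym (ℤP.*-distribˡ-+ c (f x) _))

sumℤ-neg : ∀ (f : A → ℤ) xs → sumℤ (map (λ x → - f x) xs) ≡ - sumℤ (map f xs)
sumℤ-neg f []       = refl
sumℤ-neg f (x ∷ xs) = trans (cong (ℤ._+_ (- f x)) (sumℤ-neg f xs)) (sym (ℤP.neg-distrib-+ (f x) _))

sumℤ-sublists-∷ : ∀ (f : List A → ℤ) x xs →
                  sumℤ (map f (sublists (x ∷ xs)))
                  ≡ sumℤ (map f (sublists xs)) ℤ.+ sumℤ (map (f ∘ (x ∷_)) (sublists xs))
sumℤ-sublists-∷ f x xs =
  trans (sumℤ-++ f (sublists xs) _)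
        (cong (ℤ._+_ (sumℤ (map f (sublists xs)))) (cong sumℤ (sym (map-∘ {g = f} (sublists xs)))))

module _ (M : Matroid) where
  open Matroid M
  open Degrees M

  lt? : ∀ x y → Dec (Lt _≤_ x y)
  lt? x y = (x ≤? y) ×-dec ¬? (x Fin.≟ y)

  ∨-mono : ∀ {a a′ b b′} → a ≤ a′ → b ≤ b′ → (a ∨ b) ≤ (a′ ∨ b′)
  ∨-mono a≤a′ b≤b′ = ∨-lub (≤-trans a≤a′ (∨-ubˡ _ _)) (≤-trans b≤b′ (∨-ubʳ _ _))

  ≤-isPartialOrder : IsPartialOrder _≡_ _≤_
  ≤-isPartialOrder = record
    { isPreorder = record
      { isEquivalence = isEquivalence ; reflexive = λ { refl → ≤-refl _ } ; trans = ≤-trans }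
    ; antisym = ≤-antisym }

  cover-below : ∀ {x y} → Lt _≤_ x y → ∃ λ c → Covers _≤_ x c × c ≤ y
  cover-below {x} x<y = go (po-wellFounded ≤-isPartialOrder _) x<y
    where
    go : ∀ {z} → Acc (Lt _≤_) z → Lt _≤_ x z → ∃ λ c → Covers _≤_ x c × c ≤ z
    go {z} (acc smaller) x<z with Fin.any? (λ w → lt? x w ×-dec lt? w z)
    ... | yes (w , x<w , w<z) = let c , x⋖c , c≤w = go (smaller w<z) x<w in
                                c , x⋖c , ≤-trans c≤w (proj₁ w<z)
    ... | no ∄w = z , (x<z , ends) , ≤-refl z
      where
      ends : ∀ c → x ≤ c → c ≤ z → c ≡ x ⊎ c ≡ z
      ends c x≤c c≤z with c Fin.≟ x | c Fin.≟ z
      ... | yes c≡x | _       = inj₁ c≡x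
      ... | no _    | yes c≡z = inj₂ c≡z
      ... | no c≢x  | no c≢z  = ⊥-elim (∄w (c , (x≤c , c≢x ∘ sym) , (c≤z , c≢z)))

  saturated-chain : ∀ {x y} → x ≤ y → ∃ λ cs → SatChain _≤_ x cs y
  saturated-chain {y = y} x≤y = go (po-noetherian ≤-isPartialOrder _) x≤y
    where
    go : ∀ {w} → Acc (flip (Lt _≤_)) w → w ≤ y → ∃ λ cs → SatChain _≤_ w cs y
    go {w} (acc larger) w≤y with w Fin.≟ y
    ... | yes refl = [] , done
    ... | no w≢y   = let c , w⋖c , c≤y = cover-below (w≤y , w≢y)
                         cs , c⋯y      = go (larger (proj₁ w⋖c)) c≤y in
                     c ∷ cs , step w⋖c c⋯y

  SatChain-++ : ∀ {x y z cs ds} → SatChain _≤_ x cs y → SatChain _≤_ y ds z →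
                SatChain _≤_ x (cs ++ ds) z
  SatChain-++ done         y⋯z = y⋯z
  SatChain-++ (step c x⋯y) y⋯z = step c (SatChain-++ x⋯y y⋯z)

  rk-SatChain : ∀ {x y ds} → SatChain _≤_ x ds y → rk y ≡ rk x ℕ.+ length ds
  rk-SatChain {x} {y} {ds} x⋯y = begin
    rk y                     ≡⟨ sym (ranked y _ (SatChain-++ ⊥⋯x x⋯y)) ⟩
    length (cs ++ ds)        ≡⟨ length-++ cs ⟩
    length cs ℕ.+ length ds  ≡⟨ cong (ℕ._+ length ds) (ranked x cs ⊥⋯x) ⟩
    rk x ℕ.+ length ds       ∎
    where
    open ≡-Reasoning
    cs = proj₁ (saturated-chain (⊥-min x))
    ⊥⋯x = proj₂ (saturated-chain (⊥-min x))

  rk-mono : ∀ {x y} → x ≤ y → rk x ℕ.≤ rk y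
  rk-mono x≤y = let _ , x⋯y = saturated-chain x≤y in
    ℕ.≤-trans (ℕ.m≤m+n _ _) (ℕ.≤-reflexive (sym (rk-SatChain x⋯y)))

  rk-mono-< : ∀ {x y} → x ≤ y → x ≢ y → rk x ℕ.< rk y
  rk-mono-< x≤y x≢y with saturated-chain x≤y
  ... | []    , done = ⊥-elim (x≢y refl)
  ... | _ ∷ _ , x⋯y  = ℕ.≤-trans (ℕ.m<m+n _ ℕ.z<s) (ℕ.≤-reflexive (sym (rk-SatChain x⋯y)))

  rk-⊥ : rk ⊥ₗ ≡ 0
  rk-⊥ = sym (ranked ⊥ₗ [] done)

  atom-outside : ∀ {F G} → ¬ F ≤ G → ∃ λ a → Atom a × a ≤ F × ¬ a ≤ G
  atom-outside {F} {G} F≰G with Fin.any? (λ a → atom? a ×-dec (a ≤? F) ×-dec ¬? (a ≤? G))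
  ... | yes outside = outside
  ... | no ∄a = ⊥-elim (F≰G (atomic F G λ a at a≤F →
                  decidable-stable (a ≤? G) λ a≰G → ∄a (a , at , a≤F , a≰G)))

  ∈-atomsOff : ∀ {a G} → Atom a → ¬ a ≤ G → a ∈ atomsOff G
  ∈-atomsOff {G = G} at a≰G = ∈-filter⁺ (λ a → ¬? (a ≤? G)) (∈-filter⁺ atom? (∈-allFin _) at) a≰G

  All-atomsOff : ∀ {P : Flat → Set} {G} → All P (atomsOff G) ⇔ (∀ {a} → Atom a → ¬ a ≤ G → P a)
  All-atomsOff {P} {G} = mk⇔ lookup-off tabulate-off
    where
    off? = λ a → ¬? (a ≤? G)
    lookup-off : All P (atomsOff G) → ∀ {a} → Atom a → ¬ a ≤ G → P a
    lookup-off all at a≰G = All.lookup all (∈-atomsOff at a≰G)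
    tabulate-off : (∀ {a} → Atom a → ¬ a ≤ G → P a) → All P (atomsOff G)
    tabulate-off h = All.tabulate λ m → let m′ , a≰G = ∈-filter⁻ off? {xs = atoms} m in
                                        h (proj₂ (∈-filter⁻ atom? {xs = allFin n} m′)) a≰G

  ⋁ : List Flat → Flat
  ⋁ = joinFrom ⊥ₗ

  ⋁-lub : ∀ {K xs} → All (_≤ K) xs → ⋁ xs ≤ K
  ⋁-lub []         = ⊥-min _
  ⋁-lub (x≤K ∷ xs≤K) = ∨-lub x≤K (⋁-lub xs≤K)

  ⋁-ub : ∀ {x xs} → x ∈ xs → x ≤ ⋁ xs
  ⋁-ub (here refl) = ∨-ubˡ _ _
  ⋁-ub (there m)   = ≤-trans (⋁-ub m) (∨-ubʳ _ _)

  ⋁-mono : ∀ {xs ys} → xs ⊆ ys → ⋁ xs ≤ ⋁ ys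
  ⋁-mono τ = ⋁-lub (All.tabulate (⋁-ub ∘ lookup τ))

  ⋁-≤-∨ : ∀ {us xs ys} → (∀ {u} → u ∈ us → u ∈ xs ⊎ u ∈ ys) → ⋁ us ≤ (⋁ xs ∨ ⋁ ys)
  ⋁-≤-∨ covers = ⋁-lub (All.tabulate λ m →
    [ (λ m₁ → ≤-trans (⋁-ub m₁) (∨-ubˡ _ _)) , (λ m₂ → ≤-trans (⋁-ub m₂) (∨-ubʳ _ _)) ] (covers m))

  ≤-joinFrom : ∀ G S → G ≤ joinFrom G S
  ≤-joinFrom G []      = ≤-refl G
  ≤-joinFrom G (_ ∷ S) = ≤-trans (≤-joinFrom G S) (∨-ubʳ _ _)

  joinFrom-map-∨ : ∀ G zs → joinFrom G (map (_∨ G) zs) ≡ (G ∨ ⋁ zs)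
  joinFrom-map-∨ G []       = ≤-antisym (∨-ubˡ _ _) (∨-lub (≤-refl G) (⊥-min G))
  joinFrom-map-∨ G (z ∷ zs) rewrite joinFrom-map-∨ G zs = ≤-antisym
    (∨-lub (∨-lub (≤-trans (∨-ubˡ z (⋁ zs)) (∨-ubʳ G _)) (∨-ubˡ G _))
           (∨-mono (≤-refl G) (∨-ubʳ z _)))
    (∨-lub (≤-trans (∨-ubʳ z G) (∨-ubˡ _ _))
           (∨-lub (≤-trans (∨-ubˡ z G) (∨-ubˡ _ _)) (≤-trans (∨-ubʳ G (⋁ zs)) (∨-ubʳ _ _))))

  -- Deficient flats

  HallRado : List Flat → Set
  HallRado xs = ∀ {ys} → ys ⊆ xs → length ys ℕ.≤ rk (⋁ ys)

  HallRado-⊆ : ∀ {xs ys} → ys ⊆ xs → HallRado xs → HallRado ys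
  HallRado-⊆ τ hall σ = hall (⊆-trans σ τ)

  module _ (fs : List Flat) where

    Deficient : Flat → Set
    Deficient K = ∃ λ ys → ys ⊆ fs × rk (K ∨ ⋁ ys) ℕ.≤ length ys

    deficient? : ∀ K → Dec (Deficient K)
    deficient? K = map′
      (λ any → let ys , m , h = find any in ys , ∈-sublists⁻ fs m , h)
      (λ (ys , τ , h) → lose (∈-sublists⁺ τ) h)
      (any? (λ ys → rk (K ∨ ⋁ ys) ℕ.≤? length ys) (sublists fs))

    Deficient-⊥ : Deficient ⊥ₗ
    Deficient-⊥ =
      [] , minimum fs , ℕ.≤-trans (rk-mono (∨-lub (≤-refl ⊥ₗ) (≤-refl ⊥ₗ))) (ℕ.≤-reflexive rk-⊥)

    Deficient-antitone : ∀ {K K′} → K′ ≤ K → Deficient K → Deficient K′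
    Deficient-antitone K′≤K (ys , τ , h) = ys , τ , ℕ.≤-trans (rk-mono (∨-mono K′≤K (≤-refl _))) h

    HallRado-∷ : ∀ {K} → HallRado (K ∷ fs) ⇔ (HallRado fs × ¬ Deficient K)
    HallRado-∷ {K} = mk⇔ split join
      where
      split : HallRado (K ∷ fs) → HallRado fs × ¬ Deficient K
      split hall = (λ τ → hall (K ∷ʳ τ)) , λ (ys , τ , h) → ℕ.<⇒≱ (hall (refl ∷ τ)) h
      join : HallRado fs × ¬ Deficient K → HallRado (K ∷ fs)
      join (hall , _) (_ ∷ʳ τ)   = hall τ
      join (_ , ¬def) (refl ∷ τ) = ℕ.≰⇒> λ h → ¬def (_ , τ , h)

    Deficient-∨ : HallRado fs → ∀ {K₁ K₂} → Deficient K₁ → Deficient K₂ → Deficient (K₁ ∨ K₂)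
    Deficient-∨ hall {K₁} {K₂} (ys₁ , τ₁ , h₁) (ys₂ , τ₂ , h₂) = union , union-⊆ , rk-bound
      where
      open UnionInter (⊆-union-inter τ₁ τ₂)
      open ℕ.≤-Reasoning
      Y₁ = K₁ ∨ ⋁ ys₁
      Y₂ = K₂ ∨ ⋁ ys₂
      inter-bound : length inter ℕ.≤ rk (Y₁ ∧ₗ Y₂)
      inter-bound = ℕ.≤-trans (hall (⊆-trans inter-⊆ˡ τ₁))
        (rk-mono (∧-glb (≤-trans (⋁-mono inter-⊆ˡ) (∨-ubʳ _ _))
                        (≤-trans (⋁-mono inter-⊆ʳ) (∨-ubʳ _ _))))
      join-bound : rk (Y₁ ∨ Y₂) ℕ.≤ length union
      join-bound = ℕ.+-cancelʳ-≤ (length inter) _ _ (begin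
        rk (Y₁ ∨ Y₂) ℕ.+ length inter        ≤⟨ ℕ.+-monoʳ-≤ (rk (Y₁ ∨ Y₂)) inter-bound ⟩
        rk (Y₁ ∨ Y₂) ℕ.+ rk (Y₁ ∧ₗ Y₂)       ≤⟨ submodular Y₁ Y₂ ⟩
        rk Y₁ ℕ.+ rk Y₂                      ≤⟨ ℕ.+-mono-≤ h₁ h₂ ⟩
        length ys₁ ℕ.+ length ys₂            ≡⟨ sym length-union-inter ⟩
        length union ℕ.+ length inter        ∎)
      rk-bound : rk ((K₁ ∨ K₂) ∨ ⋁ union) ℕ.≤ length union
      rk-bound = ℕ.≤-trans (rk-mono (∨-lub (∨-mono (∨-ubˡ _ _) (∨-ubˡ _ _)) ⋁union≤Y₁∨Y₂)) join-bound
        where ⋁union≤Y₁∨Y₂ = ≤-trans (⋁-≤-∨ union-∈) (∨-mono (∨-ubʳ _ _) (∨-ubʳ _ _))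

    Deficient-joinFrom : HallRado fs → ∀ G S →
                         Deficient (joinFrom G S) ⇔ (Deficient G × All (λ a → Deficient (a ∨ G)) S)
    Deficient-joinFrom hall G []      = mk⇔ (_, []) proj₁
    Deficient-joinFrom hall G (a ∷ S) = mk⇔ split join
      where
      IH = Deficient-joinFrom hall G S
      split : Deficient (a ∨ joinFrom G S) → Deficient G × All (λ a → Deficient (a ∨ G)) (a ∷ S)
      split def = let defG , defS = to IH (Deficient-antitone (∨-ubʳ _ _) def) in
                  defG , Deficient-antitone (∨-mono (≤-refl a) (≤-joinFrom G S)) def ∷ defS
      join : Deficient G × All (λ a → Deficient (a ∨ G)) (a ∷ S) → Deficient (a ∨ joinFrom G S)
      join (defG , defa ∷ defS) =
        Deficient-antitone (∨-lub (≤-trans (∨-ubˡ a G) (∨-ubˡ _ _)) (∨-ubʳ _ _))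
                           (Deficient-∨ hall defa (from IH (defG , defS)))

  StrictHallRado : Flat → List Flat → Set
  StrictHallRado G zs₀ = ∀ {z zs} → z ∷ zs ⊆ zs₀ → rk G ℕ.+ length (z ∷ zs) ℕ.< rk (G ∨ ⋁ (z ∷ zs))

  below above : Flat → List Flat → List Flat
  below G = filter (_≤? G)
  above G = filter (λ F → ¬? (F ≤? G))

  -- Deficiency is antitone, so testing the joins a ∨ G with atoms a ≰ G suffices.
  MaximalDeficient : Flat → List Flat → Set
  MaximalDeficient G fs = Deficient fs G × (∀ {a} → Atom a → ¬ a ≤ G → ¬ Deficient fs (a ∨ G))

  SplitHallRado : Flat → List Flat → Set
  SplitHallRado G fs =
    length (below G fs) ≡ rk G × HallRado (below G fs) × StrictHallRado G (above G fs)

  module _ (G : Flat) (fs : List Flat) where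

    below-⊆ : ∀ {ys} → ys ⊆ fs → below G ys ⊆ below G fs
    below-⊆ = filter⁺ (_≤? G) (_≤? G) λ { refl → id }

    above-⊆ : ∀ {ys} → ys ⊆ fs → above G ys ⊆ above G fs
    above-⊆ = filter⁺ _ _ λ { refl → id }

    StrictHallRado-≤ : StrictHallRado G (above G fs) → ∀ {zs} → zs ⊆ above G fs →
                       rk G ℕ.+ length zs ℕ.≤ rk (G ∨ ⋁ zs)
    StrictHallRado-≤ hallAbove {[]}    _ =
      ℕ.≤-trans (ℕ.≤-reflexive (ℕ.+-identityʳ _)) (rk-mono (∨-ubˡ G _))
    StrictHallRado-≤ hallAbove {_ ∷ _} τ = ℕ.<⇒≤ (hallAbove τ)

    StrictHallRado-< : StrictHallRado G (above G fs) → ∀ {K} → G ≤ K → G ≢ K →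
                       ∀ {zs} → zs ⊆ above G fs → rk G ℕ.+ length zs ℕ.< rk (K ∨ ⋁ zs)
    StrictHallRado-< hallAbove {K} G≤K G≢K {[]}    _ =
      ℕ.<-≤-trans (subst (ℕ._< rk K) (sym (ℕ.+-identityʳ _)) (rk-mono-< G≤K G≢K))
                  (rk-mono (∨-ubˡ K _))
    StrictHallRado-< hallAbove G≤K G≢K {_ ∷ _} τ =
      ℕ.<-≤-trans (hallAbove τ) (rk-mono (∨-mono G≤K (≤-refl _)))

    HallRado-below-above : HallRado (below G fs) → StrictHallRado G (above G fs) → HallRado fs
    HallRado-below-above hall hallAbove {ys} τ = ℕ.+-cancelˡ-≤ (rk G) _ _ (begin
      rk G ℕ.+ length ys                    ≡⟨ cong (rk G ℕ.+_) (sym (length-filter-¬ (_≤? G) ys)) ⟩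
      rk G ℕ.+ (length ysP ℕ.+ length ysQ)  ≡⟨ cong (rk G ℕ.+_) (ℕ.+-comm (length ysP) _) ⟩
      rk G ℕ.+ (length ysQ ℕ.+ length ysP)  ≡⟨ sym (ℕ.+-assoc (rk G) _ _) ⟩
      rk G ℕ.+ length ysQ ℕ.+ length ysP    ≤⟨ ℕ.+-mono-≤ ysQ-bound ysP-bound ⟩
      rk (⋁ ys ∨ G) ℕ.+ rk (⋁ ys ∧ₗ G)      ≤⟨ submodular (⋁ ys) G ⟩
      rk (⋁ ys) ℕ.+ rk G                    ≡⟨ ℕ.+-comm (rk (⋁ ys)) _ ⟩
      rk G ℕ.+ rk (⋁ ys)                    ∎)
      where
      open ℕ.≤-Reasoning
      ysP = below G ys
      ysQ = above G ys
      ysP-bound : length ysP ℕ.≤ rk (⋁ ys ∧ₗ G)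
      ysP-bound = ℕ.≤-trans (hall (below-⊆ τ))
        (rk-mono (∧-glb (⋁-mono (filter-⊆ _ ys)) (⋁-lub (all-filter _ ys))))
      ysQ-bound : rk G ℕ.+ length ysQ ℕ.≤ rk (⋁ ys ∨ G)
      ysQ-bound = ℕ.≤-trans (StrictHallRado-≤ hallAbove (above-⊆ τ))
        (rk-mono (∨-lub (∨-ubʳ _ _) (≤-trans (⋁-mono (filter-⊆ _ ys)) (∨-ubˡ _ _))))

    rk≤length-below⇒Deficient : rk G ℕ.≤ length (below G fs) → Deficient fs G
    rk≤length-below⇒Deficient h =
      below G fs , filter-⊆ _ fs ,
      ℕ.≤-trans (rk-mono (∨-lub (≤-refl G) (⋁-lub (all-filter _ fs)))) h

    ¬Deficient-above : length (below G fs) ℕ.≤ rk G → StrictHallRado G (above G fs) →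
                       ∀ {K} → G ≤ K → G ≢ K → ¬ Deficient fs K
    ¬Deficient-above h hallAbove {K} G≤K G≢K (ys , τ , def) = ℕ.<-irrefl refl (begin-strict
      length ys                  ≡⟨ sym (length-filter-¬ (_≤? G) ys) ⟩
      length ysP ℕ.+ length ysQ  ≤⟨ ℕ.+-monoˡ-≤ _ (ℕ.≤-trans (length-mono-≤ (below-⊆ τ)) h) ⟩
      rk G ℕ.+ length ysQ        <⟨ StrictHallRado-< hallAbove G≤K G≢K (above-⊆ τ) ⟩
      rk (K ∨ ⋁ ysQ)             ≤⟨ rk-mono (∨-mono (≤-refl K) (⋁-mono (filter-⊆ _ ys))) ⟩
      rk (K ∨ ⋁ ys)              ≤⟨ def ⟩
      length ys                  ∎)
      where
      open ℕ.≤-Reasoning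
      ysP = below G ys
      ysQ = above G ys

    -- An atom of G ∨ ⋁ ys outside G would make a ∨ G deficient, with the same witness ys.
    ⋁-below-of-maximal : MaximalDeficient G fs → ∀ {ys} → ys ⊆ fs →
                         rk (G ∨ ⋁ ys) ℕ.≤ length ys → ⋁ ys ≤ G
    ⋁-below-of-maximal (_ , ¬def) {ys} τ h = ≤-trans (∨-ubʳ G _) (atomic (G ∨ ⋁ ys) G λ a at a≤ →
      decidable-stable (a ≤? G) λ a≰G → ¬def at a≰G
        (ys , τ , ℕ.≤-trans (rk-mono (∨-lub (∨-lub a≤ (∨-ubˡ _ _)) (∨-ubʳ _ _))) h))

    length-below≡rk : HallRado fs → MaximalDeficient G fs → length (below G fs) ≡ rk G
    length-below≡rk hall maximal@((ys , τ , h) , _) = ℕ.≤-antisym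
      (ℕ.≤-trans (hall (filter-⊆ _ fs)) (rk-mono (⋁-lub (all-filter _ fs))))
      (ℕ.≤-trans (rk-mono (∨-ubˡ G _)) (ℕ.≤-trans h (length-mono-≤ ys⊆below)))
      where
      ys⊆below : ys ⊆ below G fs
      ys⊆below = subst (_⊆ below G fs)
        (filter-all (_≤? G) (All.tabulate λ m →
          ≤-trans (⋁-ub m) (⋁-below-of-maximal maximal τ h)))
        (below-⊆ τ)

    -- For an atom a ≤ z outside G, the flats below G together with z ∷ zs would otherwise
    -- witness that a ∨ G is deficient.
    MaximalDeficient⇒StrictHallRado : MaximalDeficient G fs → length (below G fs) ≡ rk G →
                                      StrictHallRado G (above G fs)
    MaximalDeficient⇒StrictHallRado (_ , ¬def) lenP {z} {zs} τ =
      let _ , at , a≤z , a≰G = atom-outside (All.head (All-resp-⊆ τ (all-filter _ fs))) in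
      via-atom at a≤z a≰G
      where
      open UnionInter (⊆-union-inter (filter-⊆ (_≤? G) fs) (⊆-trans τ (filter-⊆ _ fs)))
      inter≡[] : inter ≡ []
      inter≡[] = All∧All¬⇒[] (All-resp-⊆ inter-⊆ˡ (all-filter _ fs))
                             (All-resp-⊆ (⊆-trans inter-⊆ʳ τ) (all-filter _ fs))
      length-union : length union ≡ rk G ℕ.+ length (z ∷ zs)
      length-union = begin-equality
        length union                             ≡⟨ sym (ℕ.+-identityʳ _) ⟩
        length union ℕ.+ 0                       ≡⟨ cong ((length union ℕ.+_) ∘ length) inter≡[] ⟨
        length union ℕ.+ length inter            ≡⟨ length-union-inter ⟩
        length (below G fs) ℕ.+ length (z ∷ zs)  ≡⟨ cong (ℕ._+ length (z ∷ zs)) lenP ⟩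
        rk G ℕ.+ length (z ∷ zs)                 ∎
        where open ℕ.≤-Reasoning
      via-atom : ∀ {a} → Atom a → a ≤ z → ¬ a ≤ G →
                 rk G ℕ.+ length (z ∷ zs) ℕ.< rk (G ∨ ⋁ (z ∷ zs))
      via-atom {a} at a≤z a≰G = begin-strict
        rk G ℕ.+ length (z ∷ zs)  ≡⟨ sym length-union ⟩
        length union              <⟨ ℕ.≰⇒> (λ h → ¬def at a≰G (union , union-⊆ , h)) ⟩
        rk ((a ∨ G) ∨ ⋁ union)    ≤⟨ rk-mono (∨-lub (∨-lub a≤G∨z (∨-ubˡ _ _)) ⋁union≤G∨z) ⟩
        rk (G ∨ ⋁ (z ∷ zs))       ∎
        where
        open ℕ.≤-Reasoning
        a≤G∨z = ≤-trans a≤z (≤-trans (∨-ubˡ z _) (∨-ubʳ G _))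
        ⋁union≤G∨z = ≤-trans (⋁-≤-∨ union-∈) (∨-mono (⋁-lub (all-filter _ fs)) (≤-refl _))

    SplitHallRado⇔MaximalDeficient : SplitHallRado G fs ⇔ (HallRado fs × MaximalDeficient G fs)
    SplitHallRado⇔MaximalDeficient = mk⇔ to-maximal from-maximal
      where
      to-maximal : SplitHallRado G fs → HallRado fs × MaximalDeficient G fs
      to-maximal (lenP , hall , hallAbove) =
        HallRado-below-above hall hallAbove ,
        rk≤length-below⇒Deficient (ℕ.≤-reflexive (sym lenP)) ,
        λ {a} _ a≰G → ¬Deficient-above (ℕ.≤-reflexive lenP) hallAbove (∨-ubʳ a G)
                        λ G≡a∨G → a≰G (subst (a ≤_) (sym G≡a∨G) (∨-ubˡ a G))
      from-maximal : HallRado fs × MaximalDeficient G fs → SplitHallRado G fs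
      from-maximal (hall , maximal) =
        lenP , HallRado-⊆ (filter-⊆ _ fs) hall , MaximalDeficient⇒StrictHallRado maximal lenP
        where lenP = length-below≡rk hall maximal

  -- Degrees of monomials

  degAug-indicator : ∀ ρ R bot xs →
    IsIndicator (length xs ≡ R × (∀ {ys} → ys ⊆ xs → length ys ℕ.≤ ρ (joinFrom bot ys)))
                (degAug ρ R bot xs)
  degAug-indicator ρ R bot xs =
    _ , (proof (length xs ℕ.≟ R) ×-reflects
         allB-sublists-reflects (λ ys → proof (length ys ℕ.≤? ρ (joinFrom bot ys))) xs) , refl

  degChow-indicator : ∀ ρ R bot xs →
    IsIndicator (length xs ≡ R ∸ 1 ×
                 (∀ {y ys} → y ∷ ys ⊆ xs → suc (length (y ∷ ys)) ℕ.≤ ρ (joinFrom bot (y ∷ ys))))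
                (degChow ρ R bot xs)
  degChow-indicator ρ R bot xs =
    _ , (proof (length xs ℕ.≟ R ∸ 1) ×-reflects
         reflects-map drop-[] nonempty-bound
                      (allB-sublists-reflects nonempty-reflects xs)) , refl
    where
    Bound : List Flat → Set
    Bound []         = ⊤
    Bound ys@(_ ∷ _) = suc (length ys) ℕ.≤ ρ (joinFrom bot ys)
    nonempty-reflects : ∀ ys → Reflects (Bound ys)
      (if nonempty ys then does (suc (length ys) ℕ.≤? ρ (joinFrom bot ys)) else true)
    nonempty-reflects []         = ofʸ _
    nonempty-reflects ys@(_ ∷ _) = proof (suc (length ys) ℕ.≤? ρ (joinFrom bot ys))
    drop-[] : (∀ {ys} → ys ⊆ xs → Bound ys) → ∀ {y ys} → y ∷ ys ⊆ xs → Bound (y ∷ ys)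
    drop-[] h = h
    nonempty-bound : (∀ {y ys} → y ∷ ys ⊆ xs → Bound (y ∷ ys)) → ∀ {ys} → ys ⊆ xs → Bound ys
    nonempty-bound h {[]}    _ = _
    nonempty-bound h {_ ∷ _} τ = h τ

  hallRado? : ∀ xs → Dec (HallRado xs)
  hallRado? xs = _ because allB-sublists-reflects (λ ys → proof (length ys ℕ.≤? rk (⋁ ys))) xs

  completable? : ∀ fs → Dec (suc (length fs) ≡ r × HallRado fs)
  completable? fs = (suc (length fs) ℕ.≟ r) ×-dec hallRado? fs

  degM-∷-indicator : ∀ K fs →
    IsIndicator ((suc (length fs) ≡ r × HallRado fs) × ¬ Deficient fs K) (degM (K ∷ fs))
  degM-∷-indicator K fs = indicator-map split join (degAug-indicator rk r ⊥ₗ (K ∷ fs))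
    where
    split : suc (length fs) ≡ r × HallRado (K ∷ fs) →
            (suc (length fs) ≡ r × HallRado fs) × ¬ Deficient fs K
    split (len , hall) = let hall′ , ¬def = to (HallRado-∷ fs) hall in (len , hall′) , ¬def
    join : (suc (length fs) ≡ r × HallRado fs) × ¬ Deficient fs K →
           suc (length fs) ≡ r × HallRado (K ∷ fs)
    join ((len , hall) , ¬def) = len , from (HallRado-∷ fs) (hall , ¬def)

  degWith≡degM : ∀ H fs → degWith H fs ≡ degM (H ∷ fs)
  degWith≡degM H fs with H Fin.≟ ⊥ₗ
  ... | no _     = refl
  ... | yes refl =
    sym (indicator-absurd (λ (_ , ¬def) → ¬def (Deficient-⊥ fs)) (degM-∷-indicator ⊥ₗ fs))

  degφMono-indicator : ∀ G fs →
    IsIndicator ((length (below G fs) ≡ rk G × HallRado (below G fs)) ×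
                 (length (above G fs) ≡ r ∸ rk G ∸ 1 × StrictHallRado G (above G fs)))
                (degφMono G fs)
  degφMono-indicator G fs = indicator-* (degAug-indicator rk (rk G) ⊥ₗ (below G fs))
    (indicator-map contract expand
      (degChow-indicator (λ F → rk F ∸ rk G) (r ∸ rk G) G (map (_∨ G) (above G fs))))
    where
    Q = above G fs
    f = _∨ G
    ChowAbove : Set
    ChowAbove = ∀ {y ys} → y ∷ ys ⊆ map f Q →
                suc (length (y ∷ ys)) ℕ.≤ rk (joinFrom G (y ∷ ys)) ∸ rk G
    bound⇔ : ∀ zs → (suc (length (map f zs)) ℕ.≤ rk (joinFrom G (map f zs)) ∸ rk G)
                    ⇔ (rk G ℕ.+ length zs ℕ.< rk (G ∨ ⋁ zs))
    bound⇔ zs rewrite length-map f zs | joinFrom-map-∨ G zs = suc-≤-∸⇔ (rk-mono (∨-ubˡ G _))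
    contract : length (map f Q) ≡ r ∸ rk G ∸ 1 × ChowAbove →
               length Q ≡ r ∸ rk G ∸ 1 × StrictHallRado G Q
    contract (len , chow) =
      trans (sym (length-map f Q)) len , λ {z} {zs} τ → to (bound⇔ (z ∷ zs)) (chow (map⁺ f τ))
    expand : length Q ≡ r ∸ rk G ∸ 1 × StrictHallRado G Q →
             length (map f Q) ≡ r ∸ rk G ∸ 1 × ChowAbove
    expand (len , hallAbove) = trans (length-map f Q) len , chow
      where
      chow : ChowAbove
      chow τ with ⊆-map⁻ f Q τ
      ... | z ∷ zs , σ , refl = from (bound⇔ (z ∷ zs)) (hallAbove σ)

  alternating-sum-allB : ∀ {A : Set} (w : A → Bool) xs →
    sumℤ (map (λ S → sign (length S) ℤ.* ind (allB w S)) (sublists xs)) ≡ ind (allB (not ∘ w) xs)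
  alternating-sum-allB w []       = refl
  alternating-sum-allB w (x ∷ xs) = begin
    sumℤ (map F (sublists (x ∷ xs)))              ≡⟨ sumℤ-sublists-∷ F x xs ⟩
    ΣF ℤ.+ sumℤ (map (F ∘ (x ∷_)) (sublists xs))  ≡⟨ cong (ℤ._+_ ΣF) ΣF-∷ ⟩
    ΣF ℤ.+ - ind (w x) ℤ.* ΣF                     ≡⟨ cong (λ v → v ℤ.+ - ind (w x) ℤ.* v) IH ⟩
    ind R ℤ.+ - ind (w x) ℤ.* ind R               ≡⟨ ind-not-∧ (w x) R ⟩
    ind (not (w x) ∧ R)                           ∎
    where
    open ≡-Reasoning
    F = λ S → sign (length S) ℤ.* ind (allB w S)
    ΣF = sumℤ (map F (sublists xs))
    R = allB (not ∘ w) xs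
    IH = alternating-sum-allB w xs
    F-∷ : ∀ S → F (x ∷ S) ≡ - ind (w x) ℤ.* F S
    F-∷ S = trans (cong (- sign (length S) ℤ.*_) (ind-∧ (w x) (allB w S)))
                  (swap (sign (length S)) (ind (w x)) (ind (allB w S)))
      where
      swap : ∀ s a b → - s ℤ.* (a ℤ.* b) ≡ - a ℤ.* (s ℤ.* b)
      swap = solve-∀
    ΣF-∷ : sumℤ (map (F ∘ (x ∷_)) (sublists xs)) ≡ - ind (w x) ℤ.* ΣF
    ΣF-∷ = trans (cong sumℤ (map-cong F-∷ (sublists xs)))
                 (sumℤ-scale (- ind (w x)) F (sublists xs))

  alternating-sum≡0 : ∀ {A : Set} {x : A} {xs} → x ∈ xs →
                      sumℤ (map (sign ∘ length) (sublists xs)) ≡ + 0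
  alternating-sum≡0 {xs = y ∷ ys} _ = begin
    sumℤ (map (sign ∘ length) (sublists (y ∷ ys)))   ≡⟨ sumℤ-sublists-∷ (sign ∘ length) y ys ⟩
    Σsign ℤ.+ sumℤ (map (λ S → - sign (length S)) Ss) ≡⟨ cong (ℤ._+_ Σsign) (sumℤ-neg _ Ss) ⟩
    Σsign ℤ.+ - Σsign                                ≡⟨ ℤP.+-inverseʳ Σsign ⟩
    + 0                                              ∎
    where
    open ≡-Reasoning
    Ss = sublists ys
    Σsign = sumℤ (map (sign ∘ length) Ss)

  deficientᵇ : List Flat → Flat → Bool
  deficientᵇ fs K = does (deficient? fs K)

  deficientᵇ-joinFrom : ∀ {fs} → HallRado fs → ∀ G S →
    deficientᵇ fs (joinFrom G S) ≡ deficientᵇ fs G ∧ allB (λ a → deficientᵇ fs (a ∨ G)) S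
  deficientᵇ-joinFrom {fs} hall G S = det (proof (deficient? fs (joinFrom G S)))
    (reflects-map (from (Deficient-joinFrom fs hall G S)) (to (Deficient-joinFrom fs hall G S))
      (proof (deficient? fs G) ×-reflects allB-reflects (λ a → proof (deficient? fs (a ∨ G))) S))

  alternating-sum-deficient : ∀ {fs} → HallRado fs → ∀ G {a} xs → a ∈ xs →
    sumℤ (map (λ S → - (sign (length S) ℤ.* ind (not (deficientᵇ fs (joinFrom G S))))) (sublists xs))
    ≡ ind (deficientᵇ fs G ∧ allB (λ a → not (deficientᵇ fs (a ∨ G))) xs)
  alternating-sum-deficient {fs} hall G xs a∈xs = begin
    sumℤ (map (λ S → - (sign (length S) ℤ.* ind (not (d (joinFrom G S))))) Ss)
      ≡⟨ cong sumℤ (map-cong expand Ss) ⟩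
    sumℤ (map (λ S → ind (d G) ℤ.* F S ℤ.+ - sign (length S)) Ss)
      ≡⟨ sumℤ-+ _ _ Ss ⟩
    sumℤ (map (λ S → ind (d G) ℤ.* F S) Ss) ℤ.+ sumℤ (map (λ S → - sign (length S)) Ss)
      ≡⟨ cong₂ ℤ._+_ (sumℤ-scale (ind (d G)) F Ss) (sumℤ-neg (sign ∘ length) Ss) ⟩
    ind (d G) ℤ.* sumℤ (map F Ss) ℤ.+ - sumℤ (map (sign ∘ length) Ss)
      ≡⟨ cong₂ (λ u v → ind (d G) ℤ.* u ℤ.+ - v)
               (alternating-sum-allB w xs) (alternating-sum≡0 a∈xs) ⟩
    ind (d G) ℤ.* ind (allB (not ∘ w) xs) ℤ.+ + 0
      ≡⟨ ℤP.+-identityʳ _ ⟩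
    ind (d G) ℤ.* ind (allB (not ∘ w) xs)
      ≡⟨ sym (ind-∧ (d G) _) ⟩
    ind (d G ∧ allB (not ∘ w) xs) ∎
    where
    open ≡-Reasoning
    Ss = sublists xs
    d = deficientᵇ fs
    w = λ a → d (a ∨ G)
    F = λ S → sign (length S) ℤ.* ind (allB w S)
    expand : ∀ S → - (sign (length S) ℤ.* ind (not (d (joinFrom G S))))
                   ≡ ind (d G) ℤ.* F S ℤ.+ - sign (length S)
    expand S =
      trans (cong (λ b → - (sign (length S) ℤ.* ind (not b))) (deficientᵇ-joinFrom hall G S))
            (ind-nand (sign (length S)) (d G) (allB w S))

  degM-∷ : ∀ K fs →
    degM (K ∷ fs) ≡ ind (does (completable? fs)) ℤ.* ind (not (deficientᵇ fs K))
  degM-∷ K fs = indicator-unique id id (degM-∷-indicator K fs)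
    (indicator-* (dec-indicator (completable? fs))
                 (_ , ¬-reflects (proof (deficient? fs K)) , refl))

  degxMono≡ind : ∀ G fs → G ≢ ⊤ₗ →
    degxMono G fs ≡ ind (does (completable? fs) ∧
                         (deficientᵇ fs G ∧ allB (λ a → not (deficientᵇ fs (a ∨ G))) (atomsOff G)))
  degxMono≡ind G fs G≢⊤ = begin
    degxMono G fs                               ≡⟨ cong sumℤ (map-cong term Ss) ⟩
    sumℤ (map (λ S → ind c ℤ.* T S) Ss)         ≡⟨ sumℤ-scale (ind c) T Ss ⟩
    ind c ℤ.* sumℤ (map T Ss)                   ≡⟨ ind-*-cong (proof (completable? fs)) alternating ⟩
    ind c ℤ.* ind (d G ∧ allB w′ (atomsOff G))  ≡⟨ sym (ind-∧ c _) ⟩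
    ind (c ∧ (d G ∧ allB w′ (atomsOff G)))      ∎
    where
    open ≡-Reasoning
    Ss = sublists (atomsOff G)
    c = does (completable? fs)
    d = deficientᵇ fs
    w′ = λ a → not (d (a ∨ G))
    T = λ S → - (sign (length S) ℤ.* ind (not (d (joinFrom G S))))
    term : ∀ S → - (sign (length S) ℤ.* degWith (joinFrom G S) fs) ≡ ind c ℤ.* T S
    term S = trans (cong (λ v → - (sign (length S) ℤ.* v))
                         (trans (degWith≡degM _ fs) (degM-∷ (joinFrom G S) fs)))
                   (pull (sign (length S)) (ind c) _)
      where
      pull : ∀ s a b → - (s ℤ.* (a ℤ.* b)) ≡ a ℤ.* - (s ℤ.* b)
      pull = solve-∀
    alternating : suc (length fs) ≡ r × HallRado fs →
                  sumℤ (map T Ss) ≡ ind (d G ∧ allB w′ (atomsOff G))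
    alternating (_ , hall) =
      let _ , at , _ , a≰G = atom-outside (λ ⊤≤G → G≢⊤ (≤-antisym (⊤-max G) ⊤≤G)) in
      alternating-sum-deficient hall G (atomsOff G) (∈-atomsOff at a≰G)

  degxMono-indicator : ∀ G fs → G ≢ ⊤ₗ →
    IsIndicator ((suc (length fs) ≡ r × HallRado fs) × MaximalDeficient G fs) (degxMono G fs)
  degxMono-indicator G fs G≢⊤ =
    indicator-map (map₂ (map₂ (to All-atomsOff))) (map₂ (map₂ (from All-atomsOff)))
      (_ , (proof (completable? fs) ×-reflects proof (deficient? fs G) ×-reflects
            allB-reflects (λ a → ¬-reflects (proof (deficient? fs (a ∨ G)))) (atomsOff G))
         , degxMono≡ind G fs G≢⊤)

  degφMono≡degxMono : ∀ G fs → G ≢ ⊤ₗ → length fs ≡ r ∸ 1 → degφMono G fs ≡ degxMono G fs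
  degφMono≡degxMono G fs G≢⊤ len =
    indicator-unique to-x from-x (degφMono-indicator G fs) (degxMono-indicator G fs G≢⊤)
    where
    P = below G fs
    Q = above G fs
    suc-len : suc (length fs) ≡ r
    suc-len = trans (cong suc len)
                    (ℕ.m+[n∸m]≡n (ℕ.≤-trans (ℕ.s≤s ℕ.z≤n) (rk-mono-< (⊤-max G) G≢⊤)))
    length-above : length P ≡ rk G → length Q ≡ r ∸ rk G ∸ 1
    length-above lenP = begin
      length Q                          ≡⟨ sym (ℕ.m+n∸m≡n (length P) (length Q)) ⟩
      length P ℕ.+ length Q ∸ length P  ≡⟨ cong₂ _∸_ (trans (length-filter-¬ (_≤? G) fs) len) lenP ⟩
      r ∸ 1 ∸ rk G                      ≡⟨ ℕ.∸-+-assoc r 1 (rk G) ⟩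
      r ∸ (1 ℕ.+ rk G)                  ≡⟨ cong (r ∸_) (ℕ.+-comm 1 (rk G)) ⟩
      r ∸ (rk G ℕ.+ 1)                  ≡⟨ sym (ℕ.∸-+-assoc r (rk G) 1) ⟩
      r ∸ rk G ∸ 1                      ∎
      where open ≡-Reasoning
    to-x : (length P ≡ rk G × HallRado P) × (length Q ≡ r ∸ rk G ∸ 1 × StrictHallRado G Q) →
           (suc (length fs) ≡ r × HallRado fs) × MaximalDeficient G fs
    to-x ((lenP , hallP) , (_ , hallQ)) =
      let hall , maximal = to (SplitHallRado⇔MaximalDeficient G fs) (lenP , hallP , hallQ) in
      (suc-len , hall) , maximal
    from-x : (suc (length fs) ≡ r × HallRado fs) × MaximalDeficient G fs →
             (length P ≡ rk G × HallRado P) × (length Q ≡ r ∸ rk G ∸ 1 × StrictHallRado G Q)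
    from-x ((_ , hall) , maximal) =
      let lenP , hallP , hallQ = from (SplitHallRado⇔MaximalDeficient G fs) (hall , maximal) in
      (lenP , hallP) , (length-above lenP , hallQ)

lemma2p9 : (M : Matroid) (G : Matroid.Flat M) → G ≢ Matroid.⊤ₗ M →
    (y : Poly M) → HomogDeg M (Matroid.r M ∸ 1) y →
    degφ M G y ≡ degx M G y
lemma2p9 M G G≢⊤ []             []                = refl
-- Monomials containing h_∅ need no separate treatment: both sides vanish on them.
lemma2p9 M G G≢⊤ ((c , fs) ∷ y) ((len , _) ∷ hom) =
  cong₂ ℤ._+_ (cong (c ℤ.*_) (degφMono≡degxMono M G fs G≢⊤ len)) (lemma2p9 M G G≢⊤ y hom)
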